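{- Let $G$ be a finite simple graph that contains no induced subgraph isomorphic to $P_5$, to $\overline{P_5}$, or to $C_5$. Let $A$ and $B$ be non-empty, disjoint subsets of $V(G)$, and let $t$ be a vertex in $V(G)\setminus(A\cup B)$ such that: $t$ is anticomplete to $A$ and complete to $B$; every vertex in $B$ has a neighbor in $A$; and the induced subgraph $G[A]$ is connected. Then some vertex of $A$ is complete to $B$.
   Context: $P_n$ denotes the path on $n$ vertices, $C_n$ the cycle on $n$ vertices, and $\overline{H}$ the complement of a graph $H$. $G[S]$ denotes the subgraph of $G$ induced by $S$. For $S\subseteq V(G)$ and a vertex $v\notin S$: $v$ is complete to $S$ if $v$ is adjacent to every vertex of $S$, and anticomplete to $S$ if $v$ has no neighbor in $S$. A set $S$ is complete (resp. anticomplete) to a disjoint set $T$ if every vertex of $S$ is complete (resp. anticomplete) to $T$. -}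

module Defs where

open import Data.Nat using (ℕ; _∸_; _+_; _*_; _≡ᵇ_)
open import Data.Bool using (Bool; true; false; not; _∨_; _∧_; if_then_else_)
open import Data.Fin using (Fin; toℕ; _≟_)
open import Data.Fin.Subset using (Subset; _∈_; _∉_)
open import Data.Product using (∃; _×_; Σ)
open import Relation.Binary.PropositionalEquality using (_≡_)
open import Relation.Nullary using (¬_)
open import Relation.Nullary.Decidable using (⌊_⌋)
open import Function.Definitions using (Injective)

record Graph (n : ℕ) : Set where
  field
    adj   : Fin n → Fin n → Bool
    sym   : ∀ i j → adj i j ≡ adj j i
    irrefl : ∀ i → adj i i ≡ false
open Graph public

_~[_]_ : ∀ {n} → Fin n → Graph n → Fin n → Set
u ~[ G ] v = adj G u v ≡ true

P5adj : Fin 5 → Fin 5 → Bool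
P5adj i j = ((toℕ i ∸ toℕ j) ≡ᵇ 1) ∨ ((toℕ j ∸ toℕ i) ≡ᵇ 1)

-- C5 : cycle 0-1-2-3-4-0 (P5 plus the edge {0,4})
C5adj : Fin 5 → Fin 5 → Bool
C5adj i j = P5adj i j ∨ (((toℕ i + toℕ j) ≡ᵇ 4) ∧ ((toℕ i * toℕ j) ≡ᵇ 0))

complAdj : ∀ {k} → (Fin k → Fin k → Bool) → Fin k → Fin k → Bool
complAdj a i j = if ⌊ i ≟ j ⌋ then false else not (a i j)

HasInduced : ∀ {n k} → Graph n → (Fin k → Fin k → Bool) → Set
HasInduced {n} {k} G h =
  Σ (Fin k → Fin n) λ f → Injective _≡_ _≡_ f × (∀ i j → adj G (f i) (f j) ≡ h i j)

data PathIn {n} (G : Graph n) (A : Subset n) : Fin n → Fin n → Set where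
  here  : ∀ {x} → x ∈ A → PathIn G A x x
  there : ∀ {x z y} → x ∈ A → x ~[ G ] z → PathIn G A z y → PathIn G A x y

-- G[A] is connected (A non-emptiness is required separately)
Connected : ∀ {n} → Graph n → Subset n → Set
Connected G A = ∀ {x y} → x ∈ A → y ∈ A → PathIn G A x y

CompleteTo : ∀ {n} → Graph n → Fin n → Subset n → Set
CompleteTo G v S = ∀ {u} → u ∈ S → v ~[ G ] u

AnticompleteTo : ∀ {n} → Graph n → Fin n → Subset n → Set
AnticompleteTo G v S = ∀ {u} → u ∈ S → ¬ (v ~[ G ] u)

-- Among the vertices of A choose one whose neighbourhood in B is maximal; it
-- is complete to B. Otherwise it misses some b ∈ B. Walking in G[A] towards a
-- neighbour of b, the absence of an induced P5 starting t–b shows that a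
-- itself has a neighbour d ∈ A adjacent to b. For adjacent vertices of A the
-- neighbourhoods in B are nested, since two crossing private neighbours b₁, b₂
-- would give, together with t, an induced complement of P5 (if b₁ ~ b₂) or
-- an induced C5 (if not). So the neighbourhood of d in B strictly contains
-- that of a, contradicting maximality.
module Submission where

open import Defs
open import Data.Nat using (_<_; _∸_)
open import Data.Nat.Properties using (∸-monoʳ-<)
open import Data.Nat.Induction using (<-wellFounded)
open import Data.Fin using (Fin; zero; suc)
open import Data.Fin.Properties using (all?; ¬∀⟶∃¬)
import Data.Fin as Fin
open import Data.Fin.Subset using (Subset; _∈_; _∉_; _⊆_; _⊂_; _⊃_; _∩_; ∣_∣)
open import Data.Fin.Subset.Properties using (_∈?_; x∈p∩q⁺; x∈p∩q⁻; p⊂q⇒∣p∣<∣q∣; ∣p∣≤n)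
open import Data.Bool using (Bool; true; false)
import Data.Bool.Properties as Bool
open import Data.Vec using (tabulate)
open import Data.Vec.Properties using (lookup⇒[]=; []=⇒lookup; lookup∘tabulate)
open import Data.Product using (Σ; ∃; _×_; _,_; proj₁; proj₂)
open import Data.Sum using (_⊎_; inj₁; inj₂)
open import Data.Empty using (⊥; ⊥-elim)
open import Function.Definitions using (Injective)
open import Induction.WellFounded using (WellFounded; Acc; acc)
import Induction.WellFounded as WF
import Relation.Binary.Construct.On as On
open import Relation.Binary.PropositionalEquality using (_≡_; trans; cong)
  renaming (sym to ≡-sym)
open import Relation.Nullary using (¬_; Dec; yes; no; contradiction)
open import Relation.Nullary.Decidable using (True; toWitness; _→-dec_)

⊃-wellFounded : ∀ {n} → WellFounded (_⊃_ {n})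
⊃-wellFounded {n} = WF.Subrelation.wellFounded ⊃⇒co-size<
  (On.wellFounded (λ p → n ∸ ∣ p ∣) <-wellFounded)
  where
  ⊃⇒co-size< : ∀ {p q : Subset n} → p ⊃ q → n ∸ ∣ p ∣ < n ∸ ∣ q ∣
  ⊃⇒co-size< {p} q⊂p = ∸-monoʳ-< (p⊂q⇒∣p∣<∣q∣ q⊂p) (∣p∣≤n p)

⊂-ascent-terminates : ∀ {a b n} {X : Set a} {Q : X → Set b} (N : X → Subset n) →
  (∀ x → Q x ⊎ ∃ λ y → N x ⊂ N y) → X → ∃ Q
⊂-ascent-terminates {Q = Q} N ascend x = go x (⊃-wellFounded (N x))
  where
  go : ∀ x → Acc _⊃_ (N x) → ∃ Q
  go x (acc rs) with ascend x
  ... | inj₁ q = x , q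
  ... | inj₂ (y , Nx⊂Ny) = go y (rs Nx⊂Ny)

module Adjacency {n} (G : Graph n) where

  adj-flip : ∀ {u v c} → adj G u v ≡ c → adj G v u ≡ c
  adj-flip {u} {v} e = trans (sym G v u) e

  ≁⇒false : ∀ {u v} → ¬ u ~[ G ] v → adj G u v ≡ false
  ≁⇒false = Bool.¬-not

  _~?_ : ∀ u v → Dec (u ~[ G ] v)
  u ~? v = adj G u v Bool.≟ true

  complete-or-missing : ∀ v S → CompleteTo G v S ⊎ ∃ λ u → u ∈ S × ¬ v ~[ G ] u
  complete-or-missing v S with all? (λ u → (u ∈? S) →-dec (v ~? u))
  ... | yes complete = inj₁ λ {u} → complete u
  ... | no ¬complete with ¬∀⟶∃¬ n _ (λ u → (u ∈? S) →-dec (v ~? u)) ¬complete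
  ...   | u , ¬u∈S→v~u with u ∈? S
  ...     | yes u∈S = inj₂ (u , u∈S , λ v~u → ¬u∈S→v~u λ _ → v~u)
  ...     | no  u∉S = contradiction (λ u∈S → contradiction u∈S u∉S) ¬u∈S→v~u

  source∈ : ∀ {A x y} → PathIn G A x y → x ∈ A
  source∈ (here x∈A) = x∈A
  source∈ (there x∈A _ _) = x∈A

  neighbourhood : Fin n → Subset n
  neighbourhood v = tabulate (adj G v)

  ∈-neighbourhood⁺ : ∀ {v u} → v ~[ G ] u → u ∈ neighbourhood v
  ∈-neighbourhood⁺ {v} {u} v~u = lookup⇒[]= u _ (trans (lookup∘tabulate (adj G v) u) v~u)

  ∈-neighbourhood⁻ : ∀ {v u} → u ∈ neighbourhood v → v ~[ G ] u
  ∈-neighbourhood⁻ {v} {u} u∈N = trans (≡-sym (lookup∘tabulate (adj G v) u)) ([]=⇒lookup u∈N)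

  neighbourhoodIn : Subset n → Fin n → Subset n
  neighbourhoodIn S v = S ∩ neighbourhood v

  ∈-neighbourhoodIn⁺ : ∀ {S v u} → u ∈ S → v ~[ G ] u → u ∈ neighbourhoodIn S v
  ∈-neighbourhoodIn⁺ u∈S v~u = x∈p∩q⁺ (u∈S , ∈-neighbourhood⁺ v~u)

  ∈-neighbourhoodIn⁻ : ∀ {S v u} → u ∈ neighbourhoodIn S v → u ∈ S × v ~[ G ] u
  ∈-neighbourhoodIn⁻ {S} {v} u∈N with x∈p∩q⁻ S (neighbourhood v) u∈N
  ... | u∈S , u∈Nv = u∈S , ∈-neighbourhood⁻ u∈Nv

pattern i₀ = zero
pattern i₁ = suc zero
pattern i₂ = suc (suc zero)
pattern i₃ = suc (suc (suc zero))
pattern i₄ = suc (suc (suc (suc zero)))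

module _ {k} (h : Fin k → Fin k → Bool) where

  Symmetric? : Dec (∀ i j → h i j ≡ h j i)
  Symmetric? = all? λ i → all? λ j → h i j Bool.≟ h j i

  Irreflexive? : Dec (∀ i → h i i ≡ false)
  Irreflexive? = all? λ i → h i i Bool.≟ false

  TwinFree? : Dec (∀ i j → (∀ l → h i l ≡ h j l) → i ≡ j)
  TwinFree? = all? λ i → all? λ j → (all? λ l → h i l Bool.≟ h j l) →-dec (i Fin.≟ j)

-- For a concrete pattern the decided side conditions reduce to ⊤, so the
-- implicit arguments are filled in by eta. Twin-freeness is what makes every
-- adjacency-preserving map injective.
induced₅ : ∀ {n} (G : Graph n) (h : Fin 5 → Fin 5 → Bool)
  {_ : True (Symmetric? h)} {_ : True (Irreflexive? h)} {_ : True (TwinFree? h)}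
  (v₀ v₁ v₂ v₃ v₄ : Fin n) →
  adj G v₀ v₁ ≡ h i₀ i₁ → adj G v₀ v₂ ≡ h i₀ i₂ → adj G v₀ v₃ ≡ h i₀ i₃ → adj G v₀ v₄ ≡ h i₀ i₄ →
  adj G v₁ v₂ ≡ h i₁ i₂ → adj G v₁ v₃ ≡ h i₁ i₃ → adj G v₁ v₄ ≡ h i₁ i₄ →
  adj G v₂ v₃ ≡ h i₂ i₃ → adj G v₂ v₄ ≡ h i₂ i₄ →
  adj G v₃ v₄ ≡ h i₃ i₄ →
  HasInduced G h
induced₅ G h {sym?} {irr?} {twin?} v₀ v₁ v₂ v₃ v₄ e₀₁ e₀₂ e₀₃ e₀₄ e₁₂ e₁₃ e₁₄ e₂₃ e₂₄ e₃₄ =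
  v , v-injective , preserves
  where
  v : Fin 5 → Fin _
  v i₀ = v₀
  v i₁ = v₁
  v i₂ = v₂
  v i₃ = v₃
  v i₄ = v₄

  Preserved : Fin 5 → Fin 5 → Set
  Preserved i j = adj G (v i) (v j) ≡ h i j

  flipped : ∀ {i j} → Preserved i j → Preserved j i
  flipped {i} {j} e = trans (Adjacency.adj-flip G e) (toWitness sym? i j)

  diagonal : ∀ i → Preserved i i
  diagonal i = trans (irrefl G (v i)) (≡-sym (toWitness irr? i))

  preserves : ∀ i j → Preserved i j
  preserves i₀ i₀ = diagonal i₀
  preserves i₁ i₁ = diagonal i₁
  preserves i₂ i₂ = diagonal i₂
  preserves i₃ i₃ = diagonal i₃
  preserves i₄ i₄ = diagonal i₄
  preserves i₀ i₁ = e₀₁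
  preserves i₀ i₂ = e₀₂
  preserves i₀ i₃ = e₀₃
  preserves i₀ i₄ = e₀₄
  preserves i₁ i₂ = e₁₂
  preserves i₁ i₃ = e₁₃
  preserves i₁ i₄ = e₁₄
  preserves i₂ i₃ = e₂₃
  preserves i₂ i₄ = e₂₄
  preserves i₃ i₄ = e₃₄
  preserves i₁ i₀ = flipped e₀₁
  preserves i₂ i₀ = flipped e₀₂
  preserves i₃ i₀ = flipped e₀₃
  preserves i₄ i₀ = flipped e₀₄
  preserves i₂ i₁ = flipped e₁₂
  preserves i₃ i₁ = flipped e₁₃
  preserves i₄ i₁ = flipped e₁₄
  preserves i₃ i₂ = flipped e₂₃
  preserves i₄ i₂ = flipped e₂₄
  preserves i₄ i₃ = flipped e₃₄

  v-injective : Injective _≡_ _≡_ v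
  v-injective {i} {j} vi≡vj = toWitness twin? i j λ l →
    trans (≡-sym (preserves i l)) (trans (cong (λ w → adj G w (v l)) vi≡vj) (preserves j l))

module _ {n} (G : Graph n)
  (no-P5 : ¬ HasInduced G P5adj) (no-co-P5 : ¬ HasInduced G (complAdj P5adj))
  (no-C5 : ¬ HasInduced G C5adj)
  {A B : Subset n} {t : Fin n}
  (t-A : AnticompleteTo G t A) (t-B : CompleteTo G t B) where

  open Adjacency G

  private
    t≁ : ∀ {a} → a ∈ A → adj G t a ≡ false
    t≁ a∈A = ≁⇒false (t-A a∈A)

  adjacent-or-neighbour-adjacent : ∀ {b x y} → b ∈ B → PathIn G A x y → y ~[ G ] b →
    x ~[ G ] b ⊎ ∃ λ d → d ∈ A × x ~[ G ] d × d ~[ G ] b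
  adjacent-or-neighbour-adjacent b∈B (here _) y~b = inj₁ y~b
  adjacent-or-neighbour-adjacent {b} {x} b∈B (there {z = z} x∈A x~z z⇝y) y~b
    with x ~? b | adjacent-or-neighbour-adjacent b∈B z⇝y y~b
  ... | yes x~b | _ = inj₁ x~b
  ... | no _ | inj₁ z~b = inj₂ (z , source∈ z⇝y , x~z , z~b)
  ... | no x≁b | inj₂ (d , d∈A , z~d , d~b) with x ~? d | z ~? b
  ...   | yes x~d | _ = inj₂ (d , d∈A , x~d , d~b)
  ...   | no _ | yes z~b = inj₂ (z , source∈ z⇝y , x~z , z~b)
  ...   | no x≁d | no z≁b = contradiction
          (induced₅ G P5adj t b d z x
            (t-B b∈B) (t≁ d∈A) (t≁ (source∈ z⇝y)) (t≁ x∈A)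
            (adj-flip d~b) (adj-flip (≁⇒false z≁b)) (adj-flip (≁⇒false x≁b))
            (adj-flip z~d) (adj-flip (≁⇒false x≁d))
            (adj-flip x~z))
          no-P5

  no-crossing-private-neighbours : ∀ {x x' b₁ b₂} → x ∈ A → x' ∈ A → x ~[ G ] x' →
    b₁ ∈ B → b₂ ∈ B → x ~[ G ] b₁ → ¬ x' ~[ G ] b₁ → x' ~[ G ] b₂ → ¬ x ~[ G ] b₂ → ⊥
  no-crossing-private-neighbours {x} {x'} {b₁} {b₂} x∈A x'∈A x~x' b₁∈B b₂∈B x~b₁ x'≁b₁ x'~b₂ x≁b₂
    with b₁ ~? b₂
  ... | yes b₁~b₂ = no-co-P5 (induced₅ G (complAdj P5adj) b₁ x' t x b₂
          (adj-flip (≁⇒false x'≁b₁)) (adj-flip (t-B b₁∈B)) (adj-flip x~b₁) b₁~b₂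
          (adj-flip (t≁ x'∈A)) (adj-flip x~x') x'~b₂
          (t≁ x∈A) (t-B b₂∈B)
          (≁⇒false x≁b₂))
  ... | no b₁≁b₂ = no-C5 (induced₅ G C5adj t b₁ x x' b₂
          (t-B b₁∈B) (t≁ x∈A) (t≁ x'∈A) (t-B b₂∈B)
          (adj-flip x~b₁) (adj-flip (≁⇒false x'≁b₁)) (≁⇒false b₁≁b₂)
          x~x' (≁⇒false x≁b₂)
          x'~b₂)

  private-neighbour⇒⊆ : ∀ {x x' b} → x ∈ A → x' ∈ A → x ~[ G ] x' →
    b ∈ B → x' ~[ G ] b → ¬ x ~[ G ] b → neighbourhoodIn B x ⊆ neighbourhoodIn B x'
  private-neighbour⇒⊆ {x' = x'} x∈A x'∈A x~x' b∈B x'~b x≁b {u} u∈N with ∈-neighbourhoodIn⁻ u∈N | x' ~? u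
  ... | u∈B , _ | yes x'~u = ∈-neighbourhoodIn⁺ u∈B x'~u
  ... | u∈B , x~u | no x'≁u =
    ⊥-elim (no-crossing-private-neighbours x∈A x'∈A x~x' u∈B b∈B x~u x'≁u x'~b x≁b)

  missing⇒larger-neighbourhood : ∀ {a b y} → Connected G A → a ∈ A → b ∈ B → ¬ a ~[ G ] b →
    y ∈ A → y ~[ G ] b → ∃ λ d → d ∈ A × neighbourhoodIn B a ⊂ neighbourhoodIn B d
  missing⇒larger-neighbourhood {b = b} connected a∈A b∈B a≁b y∈A y~b
    with adjacent-or-neighbour-adjacent b∈B (connected a∈A y∈A) y~b
  ... | inj₁ a~b = contradiction a~b a≁b
  ... | inj₂ (d , d∈A , a~d , d~b) =
    d , d∈A , private-neighbour⇒⊆ a∈A d∈A a~d b∈B d~b a≁b ,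
    b , ∈-neighbourhoodIn⁺ b∈B d~b , λ b∈Na → a≁b (proj₂ (∈-neighbourhoodIn⁻ b∈Na))

lemma2p2 : ∀ {n} (G : Graph n) →
    ¬ HasInduced G P5adj → ¬ HasInduced G (complAdj P5adj) → ¬ HasInduced G C5adj →
    (A B : Subset n) (t : Fin n) →
    ∃ (λ a → a ∈ A) → ∃ (λ b → b ∈ B) →
    (∀ {x} → x ∈ A → x ∉ B) →
    t ∉ A → t ∉ B →
    AnticompleteTo G t A → CompleteTo G t B →
    (∀ {b} → b ∈ B → ∃ λ a → a ∈ A × a ~[ G ] b) →
    Connected G A →
    ∃ λ a → a ∈ A × CompleteTo G a B
lemma2p2 {n} G no-P5 no-co-P5 no-C5 A B t a₀ _ _ _ _ t-A t-B B-attached connected =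
  let ((a , a∈A) , a-complete) = ⊂-ascent-terminates B-neighbourhood ascend a₀
  in a , a∈A , a-complete
  where
  open Adjacency G

  B-neighbourhood : Σ (Fin n) (_∈ A) → Subset n
  B-neighbourhood (a , _) = neighbourhoodIn B a

  ascend : ∀ a → CompleteTo G (proj₁ a) B ⊎ ∃ λ d → B-neighbourhood a ⊂ B-neighbourhood d
  ascend (a , a∈A) with complete-or-missing a B
  ... | inj₁ a-complete = inj₁ a-complete
  ... | inj₂ (b , b∈B , a≁b) =
    let (y , y∈A , y~b) = B-attached b∈B
        (d , d∈A , N⊂N) = missing⇒larger-neighbourhood G no-P5 no-co-P5 no-C5 t-A t-B
                            connected a∈A b∈B a≁b y∈A y~b
    in inj₂ ((d , d∈A) , N⊂N)
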